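{- The partial order $(\mathbb P,\le)$ is countably closed: every decreasing sequence $p_0\ge p_1\ge p_2\ge\cdots$ of elements of $\mathbb P$ has a lower bound in $\mathbb P$.
   Context: For equivalence relations $E,F$ on a set, $E<_\infty F$ ($E$ infinitely finer than $F$) means each $F$-equivalence class is the union of infinitely many $E$-classes. $\mathbb P$ is the set of all sequences $\langle\langle E^i_j:j<n_i;X_i\rangle:i\in\omega\rangle$ where the $X_i$ are pairwise disjoint infinite subsets of $\omega$, for each $i$, $E^i_0<_\infty E^i_1<_\infty\cdots<_\infty E^i_{n_i-1}$ are equivalence relations on $X_i$ with $E^i_0$ the identity relation and $E^i_{n_i-1}$ having only one class, and $\limsup_{i\to\infty}n_i=\infty$. The order is: $\langle\langle E^i_j:j<n_i;X_i\rangle:i\in\omega\rangle\le\langle\langle F^i_j:j<m_i;Y_i\rangle:i\in\omega\rangle$ iff for all but finitely many $i$ there exist $k$ with $X_i\subseteq Y_k$ and an increasing map $\pi:n_i\to m_k$ with $E^i_j=F^k_{\pi(j)}\restriction X_i$ for all $j<n_i$. -}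

module Defs where

open import Data.Nat using (ℕ; zero; suc; _≤_; _<_; _∸_)
open import Data.Fin using (Fin; toℕ)
open import Data.Product using (Σ; ∃; _×_; _,_)
open import Data.List using (List)
open import Data.List.Relation.Unary.All using (All)
open import Data.Empty using (⊥)
open import Relation.Nullary using (¬_)
open import Relation.Binary.PropositionalEquality using (_≡_; _≢_)

Subset : Set₁
Subset = ℕ → Set

-- A binary relation on ω; it is only ever considered restricted to some X.
Relation : Set₁
Relation = ℕ → ℕ → Set

_⊆_ : Subset → Subset → Set
X ⊆ Y = ∀ a → X a → Y a

Infinite : Subset → Set
Infinite X = ∀ n → ∃ λ m → n ≤ m × X m

record IsEquivOn (X : Subset) (E : Relation) : Set where
  field
    reflOn  : ∀ a → X a → E a a
    symOn   : ∀ a b → X a → X b → E a b → E b a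
    transOn : ∀ a b c → X a → X b → X c → E a b → E b c → E a c

IsIdentityOn : Subset → Relation → Set
IsIdentityOn X E = ∀ a b → X a → X b → (E a b → a ≡ b) × (a ≡ b → E a b)

OneClassOn : Subset → Relation → Set
OneClassOn X E = ∀ a b → X a → X b → E a b

-- E <_∞ F on X: every F-class is a union of E-classes (E refines F), and
-- each F-class contains infinitely many E-classes, i.e. is not covered by
-- the E-classes of finitely many elements.
InfFinerOn : Subset → Relation → Relation → Set
InfFinerOn X E F =
  (∀ a b → X a → X b → E a b → F a b) ×
  (∀ a → X a → (L : List ℕ) →
     ∃ λ b → X b × F a b × All (λ c → ¬ E b c) L)

EqOn : Subset → Relation → Relation → Set
EqOn X E F = ∀ a b → X a → X b → (E a b → F a b) × (F a b → E a b)

record ℙ : Set₁ where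
  field
    X        : ℕ → Subset
    n        : ℕ → ℕ
    E        : (i : ℕ) → Fin (n i) → Relation
    X-inf    : ∀ i → Infinite (X i)
    X-disj   : ∀ i i' → i ≢ i' → ∀ a → X i a → X i' a → ⊥
    n-pos    : ∀ i → 0 < n i
    E-equiv  : ∀ i (j : Fin (n i)) → IsEquivOn (X i) (E i j)
    E-bottom : ∀ i (j : Fin (n i)) → toℕ j ≡ 0 → IsIdentityOn (X i) (E i j)
    E-top    : ∀ i (j : Fin (n i)) → toℕ j ≡ n i ∸ 1 → OneClassOn (X i) (E i j)
    E-chain  : ∀ i (j j' : Fin (n i)) → toℕ j' ≡ suc (toℕ j) →
               InfFinerOn (X i) (E i j) (E i j')
    n-limsup : ∀ N M → ∃ λ i → M ≤ i × N ≤ n i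

open ℙ

_≤ℙ_ : ℙ → ℙ → Set
p ≤ℙ q = ∃ λ N → ∀ i → N ≤ i → ∃ λ k →
  (X p i ⊆ X q k) ×
  Σ (Fin (n p i) → Fin (n q k)) λ π →
    (∀ j j' → toℕ j < toℕ j' → toℕ (π j) < toℕ (π j')) ×
    (∀ j → EqOn (X p i) (E p i j) (E q k (π j)))

{-# OPTIONS --safe #-}
-- Write N_k for a threshold witnessing p (suc k) ≤ℙ p k. A block of p (suc k) whose chain is
-- longer than those of all blocks of p (suc k) before N_k must lie past the threshold, so it
-- sits inside a block of p k with a chain at least as long. Accumulating these bounds along the
-- sequence, every tall enough block of p i has an ancestor block in each p k with k ≤ i. Since
-- limsup n = ∞, we can pick from each p i a block that is tall in this sense and strictly taller
-- than the block picked from p (i - 1); these blocks form the lower bound. Blocks picked from p i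
-- and p i' with i < i' are disjoint: the ancestor in p i of the latter is taller than the former,
-- so it is a different, hence disjoint, block of p i.
module Submission where

open import Defs
open import Data.Nat using (ℕ; zero; suc; _≤_; _<_; _⊔_; _≤′_; _<′_; ≤′-refl; ≤′-step; z≤n; s≤s)
open import Data.Nat.Properties
  using (≤-trans; <-trans; ≤-<-trans; <-≤-trans; <-cmp; <⇒≤; <⇒≱; ≮⇒≥; <⇒<′; ≤⇒≤′;
         m≤n⇒m<n∨m≡n; m≤m⊔n; m≤n⊔m; m⊔n<o⇒m<o; m⊔n<o⇒n<o)
open import Data.Fin using (Fin; toℕ)
import Data.Fin.Properties as Fin
open import Data.Product using (∃; _×_; _,_; proj₁; proj₂)
open import Data.Sum using (inj₁; inj₂)
open import Data.Empty using (⊥)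
open import Function using (flip)
open import Function.Definitions using (Injective)
open import Relation.Binary using (tri<; tri≈; tri>)
open import Relation.Binary.PropositionalEquality using (_≡_; _≢_; refl; sym)
open import Relation.Nullary using (contradiction)

open ℙ

Increasing : ∀ {m n} → (Fin m → Fin n) → Set
Increasing π = ∀ j j' → toℕ j < toℕ j' → toℕ (π j) < toℕ (π j')

increasing⇒injective : ∀ {m n} {π : Fin m → Fin n} → Increasing π → Injective _≡_ _≡_ π
increasing⇒injective {π = π} π↑ {j} {j'} πj≡πj' with Fin.<-cmp j j'
... | tri< j<j' _ _ = contradiction πj≡πj' (Fin.<⇒≢ (π↑ j j' j<j'))
... | tri≈ _ j≡j' _ = j≡j'
... | tri> _ _ j'<j = contradiction (sym πj≡πj') (Fin.<⇒≢ (π↑ j' j j'<j))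

increasing⇒≤ : ∀ {m n} {π : Fin m → Fin n} → Increasing π → m ≤ n
increasing⇒≤ π↑ = Fin.injective⇒≤ (increasing⇒injective π↑)

maxBelow : (ℕ → ℕ) → ℕ → ℕ
maxBelow f zero    = 0
maxBelow f (suc N) = maxBelow f N ⊔ f N

≤-maxBelow : ∀ f {N a} → a < N → f a ≤ maxBelow f N
≤-maxBelow f {suc N} (s≤s a≤N) with m≤n⇒m<n∨m≡n a≤N
... | inj₁ a<N  = ≤-trans (≤-maxBelow f a<N) (m≤m⊔n _ _)
... | inj₂ refl = m≤n⊔m _ _

-- p ≤ℙ q says that almost every block of p is of this form; a record rather than the Σ-type
-- used there, so that p and q can be inferred.
record _[_]≼_[_] (p : ℙ) (i : ℕ) (q : ℙ) (k : ℕ) : Set where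
  constructor embedding
  field
    X⊆X          : X p i ⊆ X q k
    π            : Fin (n p i) → Fin (n q k)
    π-increasing : Increasing π
    π-restricts  : ∀ j → EqOn (X p i) (E p i j) (E q k (π j))

open _[_]≼_[_] using (X⊆X; π-increasing)

≼-refl : ∀ {p i} → p [ i ]≼ p [ i ]
≼-refl = embedding (λ _ x → x) (λ j → j) (λ _ _ j<j' → j<j') (λ _ _ _ _ _ → (λ e → e) , (λ e → e))

≼-trans : ∀ {p i q k r l} → p [ i ]≼ q [ k ] → q [ k ]≼ r [ l ] → p [ i ]≼ r [ l ]
≼-trans (embedding Xi⊆Xk π π↑ π-eq) (embedding Xk⊆Xl σ σ↑ σ-eq) =
  embedding (λ a x → Xk⊆Xl a (Xi⊆Xk a x)) (λ j → σ (π j)) (λ j j' j<j' → σ↑ _ _ (π↑ j j' j<j'))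
    λ j a b xa xb →
      let ya = Xi⊆Xk a xa; yb = Xi⊆Xk b xb in
      (λ e → proj₁ (σ-eq (π j) a b ya yb) (proj₁ (π-eq j a b xa xb) e)) ,
      (λ e → proj₂ (π-eq j a b xa xb) (proj₂ (σ-eq (π j) a b ya yb) e))

≼⇒n≤n : ∀ {p i q k} → p [ i ]≼ q [ k ] → n p i ≤ n q k
≼⇒n≤n i≼k = increasing⇒≤ (π-increasing i≼k)

≤ℙ-tall-block : ∀ p q (p≤q : p ≤ℙ q) {i} → maxBelow (n p) (proj₁ p≤q) < n p i →
  ∃ λ k → p [ i ]≼ q [ k ]
≤ℙ-tall-block p q (N , below) {i} tall =
  let k , Xi⊆Xk , π , π↑ , π-eq = below i (≮⇒≥ λ i<N → <⇒≱ tall (≤-maxBelow (n p) i<N))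
  in k , embedding Xi⊆Xk π π↑ π-eq

module _ (p : ℕ → ℙ) (p↓ : ∀ k → p (suc k) ≤ℙ p k) where

  tallBound : ℕ → ℕ
  tallBound zero    = 0
  tallBound (suc k) = tallBound k ⊔ maxBelow (n (p (suc k))) (proj₁ (p↓ k))

  Tall : ℕ → ℕ → Set
  Tall k a = tallBound k < n (p k) a

  tall-parent : ∀ {k a} → Tall (suc k) a → ∃ λ a' → Tall k a' × p (suc k) [ a ]≼ p k [ a' ]
  tall-parent {k} tall
    with ≤ℙ-tall-block (p (suc k)) (p k) (p↓ k) (m⊔n<o⇒n<o (tallBound k) _ tall)
  ... | a' , a≼a' = a' , ≤-<-trans (m≤m⊔n _ _) (<-≤-trans tall (≼⇒n≤n a≼a')) , a≼a'

  tall-ancestor : ∀ {k i a} → k ≤′ i → Tall i a → ∃ λ a' → Tall k a' × p i [ a ]≼ p k [ a' ]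
  tall-ancestor ≤′-refl tall = _ , tall , ≼-refl
  tall-ancestor (≤′-step k≤i) tall with tall-parent tall
  ... | a' , tall' , a≼a' with tall-ancestor k≤i tall'
  ... | a'' , tall'' , a'≼a'' = a'' , tall'' , ≼-trans a≼a' a'≼a''

  pick : ℕ → ℕ
  pick zero    = 0
  pick (suc i) = proj₁ (n-limsup (p (suc i)) (suc (tallBound (suc i) ⊔ n (p i) (pick i))) 0)

  height : ℕ → ℕ
  height i = n (p i) (pick i)

  height-step : ∀ i → tallBound (suc i) ⊔ height i < height (suc i)
  height-step i = proj₂ (proj₂ (n-limsup (p (suc i)) (suc (tallBound (suc i) ⊔ height i)) 0))

  pick-tall : ∀ i → Tall i (pick i)
  pick-tall zero    = n-pos (p 0) 0
  pick-tall (suc i) = m⊔n<o⇒m<o _ _ (height-step i)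

  height-increasing : ∀ {i i'} → i <′ i' → height i < height i'
  height-increasing {i} ≤′-refl   = m⊔n<o⇒n<o _ _ (height-step i)
  height-increasing (≤′-step i<i') =
    <-trans (height-increasing i<i') (m⊔n<o⇒n<o _ _ (height-step _))

  i≤height : ∀ i → i ≤ height i
  i≤height zero    = z≤n
  i≤height (suc i) = ≤-<-trans (i≤height i) (height-increasing ≤′-refl)

  picks-disjoint : ∀ {i i'} → i < i' → ∀ a → X (p i) (pick i) a → X (p i') (pick i') a → ⊥
  picks-disjoint {i} {i'} i<i' a x x' with tall-ancestor (≤⇒≤′ (<⇒≤ i<i')) (pick-tall i')
  ... | a' , _ , i'≼a' = X-disj (p i) a' (pick i) a'≢pick a (X⊆X i'≼a' a x') x
    where
    a'≢pick : a' ≢ pick i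
    a'≢pick refl = <⇒≱ (height-increasing (<⇒<′ i<i')) (≼⇒n≤n i'≼a')

  diagonal : ℙ
  diagonal = record
    { X        = λ i → X (p i) (pick i)
    ; n        = height
    ; E        = λ i → E (p i) (pick i)
    ; X-inf    = λ i → X-inf (p i) (pick i)
    ; X-disj   = disjoint
    ; n-pos    = λ i → n-pos (p i) (pick i)
    ; E-equiv  = λ i → E-equiv (p i) (pick i)
    ; E-bottom = λ i → E-bottom (p i) (pick i)
    ; E-top    = λ i → E-top (p i) (pick i)
    ; E-chain  = λ i → E-chain (p i) (pick i)
    ; n-limsup = λ N M → N ⊔ M , m≤n⊔m N M , ≤-trans (m≤m⊔n N M) (i≤height (N ⊔ M))
    }
    where
    disjoint : ∀ i i' → i ≢ i' → ∀ a → X (p i) (pick i) a → X (p i') (pick i') a → ⊥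
    disjoint i i' i≢i' a with <-cmp i i'
    ... | tri< i<i' _ _ = picks-disjoint i<i' a
    ... | tri≈ _ i≡i' _ = contradiction i≡i' i≢i'
    ... | tri> _ _ i'<i = flip (picks-disjoint i'<i a)

  diagonal≤ℙ : ∀ k → diagonal ≤ℙ p k
  diagonal≤ℙ k = k , λ i k≤i →
    let a , _ , embedding Xi⊆Xa π π↑ π-eq = tall-ancestor (≤⇒≤′ k≤i) (pick-tall i)
    in a , Xi⊆Xa , π , π↑ , π-eq

lemma3p7 : (p : ℕ → ℙ) → (∀ k → p (suc k) ≤ℙ p k) →
    ∃ λ q → ∀ k → q ≤ℙ p k
lemma3p7 p p↓ = diagonal p p↓ , diagonal≤ℙ p p↓
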